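{- Let $q$ be an odd positive integer, $r$ the order of $2$ modulo $q$, and let $b$ be a semi-bad class modulo $q$. Then $\mathcal{C}_b=\{b,2b,\dots,2^{r-1}b\}$ is a coherent set. Moreover, there is no coherent set (modulo $q$) with more than $r$ elements.
   Context: The order $r$ of $2$ modulo $q$ is the least positive integer with $2^r\equiv1\pmod q$. The bad classes modulo $q$ are the elements of $\mathcal{E}(q)=\{1,2,\dots,2^{r-1}\}\subset(\mathbb{Z}/q\mathbb{Z})^*$. A class of $(\mathbb{Z}/q\mathbb{Z})^*$ is semi-bad if it does not belong to $\mathcal{E}(q)$ but its square does. A set of semi-bad classes is called coherent if it is nonempty and the product of any two of its elements (distinct elements) is a bad class. -}

module Defs where

open import Data.Nat using (ℕ; zero; suc; _+_; _*_; _^_; _≤_; _<_; NonZero)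
open import Data.Nat.DivMod using (_%_)
open import Data.Nat.Coprimality using (Coprime)
open import Data.Product using (Σ; ∃; _×_; _,_)
open import Data.List using (List; []; _∷_; map; upTo)
open import Data.List.Membership.Propositional using (_∈_)
open import Relation.Nullary using (¬_)
open import Relation.Binary.PropositionalEquality using (_≡_; _≢_)

-- Residue classes modulo q are represented by their canonical
-- representatives 0 ≤ x < q; the class x lies in (ℤ/qℤ)^* iff Coprime x q.

IsOrderOf2 : (q : ℕ) .{{_ : NonZero q}} → ℕ → Set
IsOrderOf2 q r =
  0 < r × (2 ^ r) % q ≡ 1 % q ×
  (∀ k → 0 < k → (2 ^ k) % q ≡ 1 % q → r ≤ k)

IsUnitClass : (q : ℕ) → ℕ → Set
IsUnitClass q x = x < q × Coprime x q

Bad : (q : ℕ) .{{_ : NonZero q}} → (r : ℕ) → ℕ → Set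
Bad q r x = Σ ℕ λ i → i < r × x ≡ (2 ^ i) % q

SemiBad : (q : ℕ) .{{_ : NonZero q}} → (r : ℕ) → ℕ → Set
SemiBad q r x = IsUnitClass q x × ¬ Bad q r x × Bad q r ((x * x) % q)

Coherent : (q : ℕ) .{{_ : NonZero q}} → (r : ℕ) → List ℕ → Set
Coherent q r S =
  (Σ ℕ λ x → x ∈ S) ×
  (∀ x → x ∈ S → SemiBad q r x) ×
  (∀ x y → x ∈ S → y ∈ S → x ≢ y → Bad q r ((x * y) % q))

Cset : (q : ℕ) .{{_ : NonZero q}} → (r b : ℕ) → List ℕ
Cset q r b = map (λ i → ((2 ^ i) * b) % q) (upTo r)

module Submission where

-- Say y lies in the orbit
-- of x when y ≡ 2^k·x (mod q) for some k.  Because 2^j has the inverse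
-- 2^(j·r ∸ j) modulo q, orbits are symmetric, and the list C_x enumerates
-- exactly the residues in the orbit of x.

open import Defs
open import Data.Nat using (ℕ; zero; suc; _+_; _*_; _^_; _∸_; _≤_; _<_; NonZero; >-nonZero; z≤n; s≤s)
open import Data.Nat.Properties using (*-identityˡ; *-identityʳ; *-assoc; ^-distribˡ-+-*; m≤m*n; m∸n+n≡m; _≟_)
open import Data.Nat.DivMod using (_%_; _/_; %-distribˡ-*; m%n%n≡m%n; m%n<n; m<n⇒m%n≡m; m≡m%n+[m/n]*n)
open import Data.Nat.Divisibility using (_∣_; ∣n⇒∣m*n; %-presˡ-∣; ∣n∣m%n⇒∣m)
open import Data.Nat.Coprimality using (Coprime)
open import Data.Nat.Tactic.RingSolver using (solve-∀)
open import Data.Product using (Σ; _×_; _,_; proj₁; proj₂)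
open import Data.List using (List; []; _∷_; _++_; length; map; upTo)
open import Data.List.Properties using (length-map; length-upTo; length-++-sucʳ)
open import Data.List.Membership.Propositional using (_∈_)
open import Data.List.Membership.Propositional.Properties using (∈-map⁺; ∈-map⁻; ∈-upTo⁺; ∈-∃++)
open import Data.List.Relation.Unary.Any using (here; there)
open import Data.List.Relation.Unary.All using () renaming (lookup to All-lookup)
open import Data.List.Relation.Unary.AllPairs using (_∷_)
open import Data.List.Relation.Unary.Unique.Propositional using (Unique)
open import Data.Empty using (⊥-elim)
open import Relation.Nullary using (yes; no)
open import Relation.Binary.Bundles using (Setoid)
open import Relation.Binary.PropositionalEquality using (_≡_; _≢_; refl; sym; trans; cong; subst; module ≡-Reasoning)

∈-delete : {A : Set} {x y : A} (us vs : List A) → y ∈ us ++ x ∷ vs → y ≢ x → y ∈ us ++ vs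
∈-delete []       vs (here y≡x)  y≢x = ⊥-elim (y≢x y≡x)
∈-delete []       vs (there y∈)  y≢x = y∈
∈-delete (u ∷ us) vs (here y≡u)  y≢x = here y≡u
∈-delete (u ∷ us) vs (there y∈)  y≢x = there (∈-delete us vs y∈ y≢x)

unique-⊆⇒length≤ : {A : Set} (S T : List A) → Unique S → (∀ y → y ∈ S → y ∈ T) →
  length S ≤ length T
unique-⊆⇒length≤ []       T _             _ = z≤n
unique-⊆⇒length≤ (x ∷ xs) T (x∉xs ∷ uniq) S⊆T with ∈-∃++ (S⊆T x (here refl))
... | us , vs , refl =
  subst (suc (length xs) ≤_) (sym (length-++-sucʳ us x vs))
    (s≤s (unique-⊆⇒length≤ xs (us ++ vs) uniq xs⊆us++vs))
  where
  xs⊆us++vs : ∀ y → y ∈ xs → y ∈ us ++ vs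
  xs⊆us++vs y y∈xs =
    ∈-delete us vs (S⊆T y (there y∈xs)) (λ y≡x → All-lookup x∉xs y∈xs (sym y≡x))

module Modular (q : ℕ) .{{_ : NonZero q}} where

  infix 4 _≈_
  -- Two numbers are congruent when they have the same residue.  A record
  -- (rather than a bare equation of residues) lets Agda infer both sides.
  record _≈_ (a b : ℕ) : Set where
    constructor same-residue
    field residue-eq : a % q ≡ b % q
  open _≈_

  ≈-setoid : Setoid _ _
  ≈-setoid = record
    { Carrier = ℕ
    ; _≈_ = _≈_
    ; isEquivalence = record
      { refl  = same-residue refl
      ; sym   = λ a≈b → same-residue (sym (residue-eq a≈b))
      ; trans = λ a≈b b≈c → same-residue (trans (residue-eq a≈b) (residue-eq b≈c))
      }
    }

  open Setoid ≈-setoid using () renaming (refl to ≈-refl; sym to ≈-sym; trans to ≈-trans)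

  ≡⇒≈ : ∀ {a b} → a ≡ b → a ≈ b
  ≡⇒≈ a≡b = same-residue (cong (_% q) a≡b)

  mod-≈ : ∀ a → a % q ≈ a
  mod-≈ a = same-residue (m%n%n≡m%n a q)

  residue-≡ : ∀ {x a} → x < q → x ≈ a → x ≡ a % q
  residue-≡ x<q x≈a = trans (sym (m<n⇒m%n≡m x<q)) (residue-eq x≈a)

  *-cong : ∀ {a a' b b'} → a ≈ a' → b ≈ b' → a * b ≈ a' * b'
  *-cong {a} {a'} {b} {b'} (same-residue a≡a') (same-residue b≡b') = same-residue (begin
    (a * b) % q               ≡⟨ %-distribˡ-* a b q ⟩
    ((a % q) * (b % q)) % q   ≡⟨ cong (λ t → (t * (b % q)) % q) a≡a' ⟩
    ((a' % q) * (b % q)) % q  ≡⟨ cong (λ t → ((a' % q) * t) % q) b≡b' ⟩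
    ((a' % q) * (b' % q)) % q ≡⟨ %-distribˡ-* a' b' q ⟨
    (a' * b') % q             ∎)
    where open ≡-Reasoning

  *-congˡ : ∀ a {b b'} → b ≈ b' → a * b ≈ a * b'
  *-congˡ a = *-cong (≈-refl {a})

  *-congʳ : ∀ c {a a'} → a ≈ a' → a * c ≈ a' * c
  *-congʳ c a≈a' = *-cong a≈a' (≈-refl {c})

  ∣-resp-≈ : ∀ {d a c} → d ∣ q → a ≈ c → d ∣ a → d ∣ c
  ∣-resp-≈ {d} d∣q (same-residue a≡c) d∣a =
    ∣n∣m%n⇒∣m d∣q (subst (d ∣_) a≡c (%-presˡ-∣ d∣a d∣q))

  coprime-factor : ∀ {b y} u → b ≈ u * y → Coprime b q → Coprime y q
  coprime-factor u b≈uy b⊥q (d∣y , d∣q) =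
    b⊥q (∣-resp-≈ d∣q (≈-sym b≈uy) (∣n⇒∣m*n u d∣y) , d∣q)

  module Periodic (r : ℕ) (r>0 : 0 < r) (period : 2 ^ r ≈ 1) where
    open import Relation.Binary.Reasoning.Setoid ≈-setoid

    private instance
      r≢0 : NonZero r
      r≢0 = >-nonZero r>0

    pow-period-multiple : ∀ n → 2 ^ (n * r) ≈ 1
    pow-period-multiple zero    = ≈-refl
    pow-period-multiple (suc n) = begin
      2 ^ (r + n * r)     ≡⟨ ^-distribˡ-+-* 2 r (n * r) ⟩
      2 ^ r * 2 ^ (n * r) ≈⟨ *-cong period (pow-period-multiple n) ⟩
      1                   ∎

    pow-reduce : ∀ k → 2 ^ k ≈ 2 ^ (k % r)
    pow-reduce k = begin
      2 ^ k                                ≡⟨ cong (2 ^_) (m≡m%n+[m/n]*n k r) ⟩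
      2 ^ (k % r + (k / r) * r)            ≡⟨ ^-distribˡ-+-* 2 (k % r) ((k / r) * r) ⟩
      2 ^ (k % r) * 2 ^ ((k / r) * r)      ≈⟨ *-congˡ (2 ^ (k % r)) (pow-period-multiple (k / r)) ⟩
      2 ^ (k % r) * 1                      ≡⟨ *-identityʳ (2 ^ (k % r)) ⟩
      2 ^ (k % r)                          ∎

    inv-exp : ℕ → ℕ
    inv-exp j = j * r ∸ j

    pow-inverse : ∀ j → 2 ^ inv-exp j * 2 ^ j ≈ 1
    pow-inverse j = begin
      2 ^ inv-exp j * 2 ^ j  ≡⟨ ^-distribˡ-+-* 2 (inv-exp j) j ⟨
      2 ^ (inv-exp j + j)    ≡⟨ cong (2 ^_) (m∸n+n≡m (m≤m*n j r)) ⟩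
      2 ^ (j * r)            ≈⟨ pow-period-multiple j ⟩
      1                      ∎

    pow-cancel : ∀ j {a c} → 2 ^ j * a ≈ c → a ≈ 2 ^ inv-exp j * c
    pow-cancel j {a} {c} 2ʲa≈c = begin
      a                            ≡⟨ *-identityˡ a ⟨
      1 * a                        ≈⟨ *-congʳ a (pow-inverse j) ⟨
      2 ^ inv-exp j * 2 ^ j * a    ≡⟨ *-assoc (2 ^ inv-exp j) (2 ^ j) a ⟩
      2 ^ inv-exp j * (2 ^ j * a)  ≈⟨ *-congˡ (2 ^ inv-exp j) 2ʲa≈c ⟩
      2 ^ inv-exp j * c            ∎

    Pow2 : ℕ → Set
    Pow2 x = Σ ℕ λ k → x ≈ 2 ^ k

    Orbit : ℕ → ℕ → Set
    Orbit x y = Σ ℕ λ k → y ≈ 2 ^ k * x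

    pow2-pow : ∀ k → Pow2 (2 ^ k)
    pow2-pow k = k , ≈-refl

    pow2-resp : ∀ {a b} → a ≈ b → Pow2 b → Pow2 a
    pow2-resp a≈b (k , b≈2ᵏ) = k , ≈-trans a≈b b≈2ᵏ

    pow2-* : ∀ {a b} → Pow2 a → Pow2 b → Pow2 (a * b)
    pow2-* {a} {b} (k , a≈2ᵏ) (l , b≈2ˡ) = k + l , (begin
      a * b          ≈⟨ *-cong a≈2ᵏ b≈2ˡ ⟩
      2 ^ k * 2 ^ l  ≡⟨ ^-distribˡ-+-* 2 k l ⟨
      2 ^ (k + l)    ∎)

    bad⇒pow2 : ∀ {x} → Bad q r x → Pow2 x
    bad⇒pow2 {x} (i , _ , x≡2ⁱ%q) = i , ≈-trans (≡⇒≈ x≡2ⁱ%q) (mod-≈ (2 ^ i))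

    pow2⇒bad : ∀ {x} → x < q → Pow2 x → Bad q r x
    pow2⇒bad x<q (k , x≈2ᵏ) = k % r , m%n<n k r , residue-≡ x<q (≈-trans x≈2ᵏ (pow-reduce k))

    bad-residue⇒pow2 : ∀ {a} → Bad q r (a % q) → Pow2 a
    bad-residue⇒pow2 {a} bad = pow2-resp (≈-sym (mod-≈ a)) (bad⇒pow2 bad)

    pow2⇒bad-residue : ∀ {a} → Pow2 a → Bad q r (a % q)
    pow2⇒bad-residue {a} p = pow2⇒bad (m%n<n a q) (pow2-resp (mod-≈ a) p)

    ∈C⇒residue : ∀ {x y} → y ∈ Cset q r x → y < q
    ∈C⇒residue {x} y∈C with ∈-map⁻ (λ i → (2 ^ i * x) % q) y∈C
    ... | i , _ , refl = m%n<n (2 ^ i * x) q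

    ∈C⇒orbit : ∀ {x y} → y ∈ Cset q r x → Orbit x y
    ∈C⇒orbit {x} y∈C with ∈-map⁻ (λ i → (2 ^ i * x) % q) y∈C
    ... | i , _ , refl = i , mod-≈ (2 ^ i * x)

    orbit⇒∈C : ∀ {x y} → y < q → Orbit x y → y ∈ Cset q r x
    orbit⇒∈C {x} {y} y<q (k , y≈2ᵏx) =
      subst (_∈ Cset q r x) (sym y≡) (∈-map⁺ (λ i → (2 ^ i * x) % q) (∈-upTo⁺ (m%n<n k r)))
      where
      y≡ : y ≡ (2 ^ (k % r) * x) % q
      y≡ = residue-≡ y<q (≈-trans y≈2ᵏx (*-congʳ x (pow-reduce k)))

    length-C : ∀ x → length (Cset q r x) ≡ r
    length-C x = trans (length-map (λ i → (2 ^ i * x) % q) (upTo r)) (length-upTo r)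

    orbit-sym : ∀ {x y} → Orbit x y → Orbit y x
    orbit-sym (k , y≈2ᵏx) = inv-exp k , pow-cancel k (≈-sym y≈2ᵏx)

    orbit-coprime : ∀ {x y} → Orbit x y → Coprime x q → Coprime y q
    orbit-coprime x~y with orbit-sym x~y
    ... | k , x≈2ᵏy = coprime-factor (2 ^ k) x≈2ᵏy

    orbit-pow2 : ∀ {x y} → Orbit x y → Pow2 x → Pow2 y
    orbit-pow2 (k , y≈2ᵏx) x-pow2 = pow2-resp y≈2ᵏx (pow2-* (pow2-pow k) x-pow2)

    orbit-product-pow2 : ∀ {b y z} → Pow2 (b * b) → Orbit b y → Orbit b z → Pow2 (y * z)
    orbit-product-pow2 {b} {y} {z} bb-pow2 (k , y≈2ᵏb) (l , z≈2ˡb) =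
      pow2-resp yz≈ (pow2-* (pow2-* (pow2-pow k) (pow2-pow l)) bb-pow2)
      where
      regroup : ∀ a c b → (a * b) * (c * b) ≡ (a * c) * (b * b)
      regroup = solve-∀
      yz≈ : y * z ≈ (2 ^ k * 2 ^ l) * (b * b)
      yz≈ = begin
        y * z                     ≈⟨ *-cong y≈2ᵏb z≈2ˡb ⟩
        (2 ^ k * b) * (2 ^ l * b) ≡⟨ regroup (2 ^ k) (2 ^ l) b ⟩
        (2 ^ k * 2 ^ l) * (b * b) ∎

    square-product-orbit : ∀ {x y} → Pow2 (x * x) → Pow2 (x * y) → Orbit x y
    square-product-orbit {x} {y} (j , xx≈2ʲ) (i , xy≈2ⁱ) =
      inv-exp j + i , (begin
        y                           ≈⟨ pow-cancel j 2ʲy≈2ⁱx ⟩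
        2 ^ inv-exp j * (2 ^ i * x) ≡⟨ *-assoc (2 ^ inv-exp j) (2 ^ i) x ⟨
        2 ^ inv-exp j * 2 ^ i * x   ≡⟨ cong (_* x) (^-distribˡ-+-* 2 (inv-exp j) i) ⟨
        2 ^ (inv-exp j + i) * x     ∎)
      where
      regroup : ∀ x y → (x * x) * y ≡ (x * y) * x
      regroup = solve-∀
      2ʲy≈2ⁱx : 2 ^ j * y ≈ 2 ^ i * x
      2ʲy≈2ⁱx = begin
        2 ^ j * y    ≈⟨ *-congʳ y xx≈2ʲ ⟨
        (x * x) * y  ≡⟨ regroup x y ⟩
        (x * y) * x  ≈⟨ *-congʳ x xy≈2ⁱ ⟩
        2 ^ i * x    ∎

    Cset-coherent : ∀ b → SemiBad q r b → Coherent q r (Cset q r b)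
    Cset-coherent b ((b<q , b⊥q) , b-not-bad , bb-bad) =
      ((2 ^ 0 * b) % q , ∈-map⁺ (λ i → (2 ^ i * b) % q) (∈-upTo⁺ r>0)) ,
      semi-bad , (λ y z y∈C z∈C _ → product-bad y∈C z∈C)
      where
      product-bad : ∀ {y z} → y ∈ Cset q r b → z ∈ Cset q r b → Bad q r ((y * z) % q)
      product-bad y∈C z∈C = pow2⇒bad-residue
        (orbit-product-pow2 (bad-residue⇒pow2 bb-bad) (∈C⇒orbit y∈C) (∈C⇒orbit z∈C))
      semi-bad : ∀ y → y ∈ Cset q r b → SemiBad q r y
      semi-bad y y∈C =
        (∈C⇒residue y∈C , orbit-coprime (∈C⇒orbit y∈C) b⊥q) ,
        (λ y-bad → b-not-bad (pow2⇒bad b<q (orbit-pow2 (orbit-sym (∈C⇒orbit y∈C)) (bad⇒pow2 y-bad)))) ,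
        product-bad y∈C y∈C

    -- Second claim: a coherent set containing x lies inside C_x, so has at most r elements.
    coherent-length≤ : ∀ S → Unique S → Coherent q r S → length S ≤ r
    coherent-length≤ []       _    _                           = z≤n
    coherent-length≤ (x ∷ xs) uniq (_ , semi-bad , product-bad) =
      subst (length (x ∷ xs) ≤_) (length-C x) (unique-⊆⇒length≤ (x ∷ xs) (Cset q r x) uniq S⊆C)
      where
      x-product-pow2 : ∀ y → y ∈ x ∷ xs → Pow2 (x * y)
      x-product-pow2 y y∈S with y ≟ x
      ... | yes refl = bad-residue⇒pow2 (proj₂ (proj₂ (semi-bad x (here refl))))
      ... | no y≢x   = bad-residue⇒pow2 (product-bad x y (here refl) y∈S (λ x≡y → y≢x (sym x≡y)))
      S⊆C : ∀ y → y ∈ x ∷ xs → y ∈ Cset q r x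
      S⊆C y y∈S = orbit⇒∈C (proj₁ (proj₁ (semi-bad y y∈S)))
        (square-product-orbit (x-product-pow2 x (here refl)) (x-product-pow2 y y∈S))

lemma2 : (q : ℕ) .{{_ : NonZero q}} → q % 2 ≡ 1 → (r : ℕ) → IsOrderOf2 q r →
    ((b : ℕ) → SemiBad q r b → Coherent q r (Cset q r b)) ×
    ((S : List ℕ) → Unique S → Coherent q r S → length S ≤ r)
lemma2 q _ r (r>0 , 2ʳ≡1 , _) = Cset-coherent , coherent-length≤
  where
  open Modular q
  open Periodic r r>0 (same-residue 2ʳ≡1)
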